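{- For every integer $n\ge 1$, the $n$-dimensional hypercube graph $Q_n$ is a $G$-graph.
   Context: The hypercube graph $Q_n$ has vertex set $\{0,1\}^n$, two vertices being adjacent iff they differ in exactly one coordinate; it is bipartite, $n$-regular, with $2^n$ vertices and $2^{n-1}n$ edges. For a group $G$ and a finite family $S=\{s_1,\dots,s_k\}$ of elements generating $G$ (repetitions allowed), the $G$-graph $\Gamma(G,S)$ is the loopless multigraph with vertex set the disjoint union of the sets $V_{s_i}$ of right cosets $\langle s_i\rangle x$ ($x\in G$), where for $i\ne j$, $\langle s_i\rangle x$ and $\langle s_j\rangle y$ are joined by exactly $|\langle s_i\rangle x\cap\langle s_j\rangle y|$ parallel edges and vertices in the same $V_{s_i}$ are non-adjacent. A graph is a $G$-graph if it is isomorphic to $\Gamma(G,S)$ for some group $G$ and some finite generating (multi)set $S$. -}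

module Defs where

open import Level using (0ℓ)
open import Algebra.Bundles using (Group)
open import Data.Nat using (ℕ; zero; suc)
open import Data.Integer using (ℤ; +_; -[1+_])
open import Data.Fin using (Fin)
open import Data.Vec using (Vec; lookup)
open import Data.Bool using (Bool)
open import Data.Product using (Σ; ∃; _×_; _,_)
open import Relation.Binary.PropositionalEquality using (_≡_; _≢_)
open import Relation.Nullary using (¬_)

QAdj : ∀ {n} → Vec Bool n → Vec Bool n → Set
QAdj {n} u v =
  Σ (Fin n) λ c → (lookup u c ≢ lookup v c) × (∀ j → j ≢ c → lookup u j ≡ lookup v j)

module GGraph (G : Group 0ℓ 0ℓ) where
  open Group G

  _^ℕ_ : Carrier → ℕ → Carrier
  x ^ℕ zero = ε
  x ^ℕ suc m = x ∙ (x ^ℕ m)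

  _^ℤ_ : Carrier → ℤ → Carrier
  x ^ℤ (+ m) = x ^ℕ m
  x ^ℤ -[1+ m ] = (x ^ℕ suc m) ⁻¹

  InCoset : Carrier → Carrier → Carrier → Set
  InCoset g s x = ∃ λ (z : ℤ) → g ≈ ((s ^ℤ z) ∙ x)

  data Generated {k : ℕ} (S : Fin k → Carrier) : Carrier → Set where
    gen  : ∀ i → Generated S (S i)
    unit : Generated S ε
    mul  : ∀ {a b} → Generated S a → Generated S b → Generated S (a ∙ b)
    inv  : ∀ {a} → Generated S a → Generated S (a ⁻¹)
    resp : ∀ {a b} → a ≈ b → Generated S a → Generated S b

  Generates : ∀ {k} → (Fin k → Carrier) → Set
  Generates S = ∀ g → Generated S g

  -- A vertex of Γ(G,S) is represented by a pair (i , x), standing for the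
  -- coset ⟨s_i⟩x in the part V_{s_i}.
  Vertex : ℕ → Set
  Vertex k = Fin k × Carrier

  SameVertex : ∀ {k} → (Fin k → Carrier) → Vertex k → Vertex k → Set
  SameVertex S (i , x) (j , y) = (i ≡ j) × InCoset x (S i) y

  HasExactly : (Carrier → Set) → ℕ → Set
  HasExactly P m =
    Σ (Fin m → Carrier) λ e →
      (∀ a → P (e a)) ×
      (∀ a b → e a ≈ e b → a ≡ b) ×
      (∀ g → P g → ∃ λ a → g ≈ e a)

  EdgeMult : ∀ {k} → (Fin k → Carrier) → Vertex k → Vertex k → ℕ → Set
  EdgeMult S (i , x) (j , y) m =
    (i ≡ j → m ≡ 0) ×
    (i ≢ j → HasExactly (λ g → InCoset g (S i) x × InCoset g (S j) y) m)

  IsoToHypercube : ∀ {k} → (Fin k → Carrier) → ℕ → Set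
  IsoToHypercube {k} S n =
    Σ (Vertex k → Vec Bool n) λ f →
      (∀ u v → SameVertex S u v → f u ≡ f v) ×
      (∀ u v → f u ≡ f v → SameVertex S u v) ×
      (∀ w → ∃ λ u → f u ≡ w) ×
      (∀ u v → (QAdj (f u) (f v) → EdgeMult S u v 1) ×
               (¬ QAdj (f u) (f v) → EdgeMult S u v 0))

HypercubeIsGGraph : ℕ → Set₁
HypercubeIsGGraph n =
  Σ (Group 0ℓ 0ℓ) λ G → let open GGraph G in
    Σ ℕ λ k → Σ (Fin k → Group.Carrier G) λ S →
      Generates S × IsoToHypercube S n

-- The group is G = E_n ⋊ Z_n, where E_n is the even-weight subspace of
-- (Z_2)^n and Z_n rotates coordinates (|G| = n·2^(n-1); this description is
-- only motivation and is not used below).  It is realised concretely as a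
-- permutation group of the set of "directed edges" (u , d) of Q_n (a vertex u
-- and a direction d), generated by two permutations of order n:
--   s₀ : (u , d) ↦ (u , d+1),        s₁ : (u , d) ↦ (u ⊕ e_d ⊕ e_(d+1) , d+1).
-- A state (u , d) encodes the edge {u , u ⊕ e_d}; the ⟨s₀⟩-orbits are labelled
-- by the endpoint u and the ⟨s₁⟩-orbits by the endpoint u ⊕ e_d.
module Submission where

open import Defs
open import Level using (0ℓ)
open import Algebra.Bundles using (Group; CommutativeRing)
open import Data.Nat using (ℕ; zero; suc; _+_; _*_; _∸_; _%_; _≤_; s≤s; z≤n)
open import Data.Nat.Properties using (+-comm; +-assoc; +-suc; +-identityʳ; m+[n∸m]≡n; <⇒≤)
open import Data.Nat.DivMod using (_mod_; %-distribˡ-+; m%n%n≡m%n; [m+n]%n≡m%n; m<n⇒m%n≡m; m%n<n)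
open import Data.Nat.GeneralisedArithmetic using (fold; fold-+)
import Data.Integer as ℤ
open import Data.Fin using (Fin; zero; suc; toℕ; inject₁)
open import Data.Fin.Properties using (_≟_; toℕ-fromℕ<; toℕ<n; toℕ-injective; toℕ-inject₁)
open import Data.Vec using (Vec; []; _∷_; lookup; zipWith; tabulate; tail)
import Data.Vec as Vec
open import Data.Vec.Properties
  using (zipWith-assoc; zipWith-comm; zipWith-identityˡ; zipWith-identityʳ; lookup-zipWith;
         lookup-replicate; tabulate∘lookup; tabulate-cong; lookup∘tabulate)
open import Data.List using (List; []; _∷_; _++_; replicate)
open import Data.List.Properties using (++-assoc; ++-identityʳ)
open import Data.Bool using (Bool; true; false; _xor_; not)
open import Data.Bool.Properties
  using (xor-assoc; xor-comm; xor-identityˡ; xor-identityʳ; xor-same; not-¬; ¬-not; xor-∧-commutativeRing)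
open import Algebra.Properties.CommutativeSemigroup
  (CommutativeRing.+-commutativeSemigroup xor-∧-commutativeRing) using () renaming (interchange to xor-interchange)
open import Data.Product using (∃; _×_; _,_; proj₁; proj₂)
open import Data.Empty using (⊥-elim)
open import Function using (_∘′_)
open import Relation.Nullary using (¬_; yes; no)
open import Relation.Binary.PropositionalEquality

-- Words over an alphabet B of permutations of E, each of order dividing
-- suc m, modulo equality of their action, form a group: the permutation
-- group generated by the letters.
module WordGroup {B E : Set} (gen : B → E → E) (m : ℕ)
                 (gen-order : ∀ b x → fold x (gen b) (suc m) ≡ x) where

  Word : Set
  Word = List B

  act : Word → E → E
  act []      x = x
  act (b ∷ w) x = gen b (act w x)

  act-++ : ∀ v w x → act (v ++ w) x ≡ act v (act w x)
  act-++ []      w x = refl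
  act-++ (b ∷ v) w x = cong (gen b) (act-++ v w x)

  act-replicate : ∀ k b x → act (replicate k b) x ≡ fold x (gen b) k
  act-replicate zero    b x = refl
  act-replicate (suc k) b x = cong (gen b) (act-replicate k b x)

  gen-inverseˡ : ∀ b x → fold (gen b x) (gen b) m ≡ x
  gen-inverseˡ b x = begin
    fold (gen b x) (gen b) m ≡⟨ sym (fold-+ x (gen b) m) ⟩
    fold x (gen b) (m + 1)   ≡⟨ cong (fold x (gen b)) (+-comm m 1) ⟩
    fold x (gen b) (suc m)   ≡⟨ gen-order b x ⟩
    x                        ∎
    where open ≡-Reasoning

  inv : Word → Word
  inv []      = []
  inv (b ∷ w) = inv w ++ replicate m b

  act-invˡ : ∀ w x → act (inv w) (act w x) ≡ x
  act-invˡ []      x = refl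
  act-invˡ (b ∷ w) x = begin
    act (inv w ++ replicate m b) (gen b (act w x))   ≡⟨ act-++ (inv w) _ _ ⟩
    act (inv w) (act (replicate m b) (gen b (act w x)))
      ≡⟨ cong (act (inv w)) (act-replicate m b _) ⟩
    act (inv w) (fold (gen b (act w x)) (gen b) m)  ≡⟨ cong (act (inv w)) (gen-inverseˡ b _) ⟩
    act (inv w) (act w x)                            ≡⟨ act-invˡ w x ⟩
    x                                                ∎
    where open ≡-Reasoning

  act-invʳ : ∀ w x → act w (act (inv w) x) ≡ x
  act-invʳ []      x = refl
  act-invʳ (b ∷ w) x = begin
    gen b (act w (act (inv w ++ replicate m b) x))
      ≡⟨ cong (λ y → gen b (act w y)) (act-++ (inv w) _ x) ⟩
    gen b (act w (act (inv w) (act (replicate m b) x))) ≡⟨ cong (gen b) (act-invʳ w _) ⟩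
    gen b (act (replicate m b) x)                       ≡⟨ cong (gen b) (act-replicate m b x) ⟩
    fold x (gen b) (suc m)                              ≡⟨ gen-order b x ⟩
    x                                                   ∎
    where open ≡-Reasoning

  _≈_ : Word → Word → Set
  v ≈ w = ∀ x → act v x ≡ act w x

  group : Group 0ℓ 0ℓ
  group = record
    { Carrier = Word ; _≈_ = _≈_ ; _∙_ = _++_ ; ε = [] ; _⁻¹ = inv
    ; isGroup = record
      { isMonoid = record
        { isSemigroup = record
          { isMagma = record
            { isEquivalence = record
              { refl = λ x → refl ; sym = λ p x → sym (p x) ; trans = λ p q x → trans (p x) (q x) }
            ; ∙-cong = λ {u} {v} {u′} {v′} → ∙-cong u v u′ v′ }
          ; assoc = λ u v w x → cong (λ t → act t x) (++-assoc u v w) }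
        ; identity = (λ w x → refl) , (λ w x → cong (λ t → act t x) (++-identityʳ w)) }
      ; inverse = (λ w x → trans (act-++ (inv w) w x) (act-invˡ w x))
                , (λ w x → trans (act-++ w (inv w) x) (act-invʳ w x))
      ; ⁻¹-cong = λ {v} {w} → ⁻¹-cong v w } }
    where
      ∙-cong : ∀ u v u′ v′ → u ≈ v → u′ ≈ v′ → (u ++ u′) ≈ (v ++ v′)
      ∙-cong u v u′ v′ p q x = begin
        act (u ++ u′) x  ≡⟨ act-++ u u′ x ⟩
        act u (act u′ x) ≡⟨ cong (act u) (q x) ⟩
        act u (act v′ x) ≡⟨ p _ ⟩
        act v (act v′ x) ≡⟨ act-++ v v′ x ⟨
        act (v ++ v′) x  ∎
        where open ≡-Reasoning
      ⁻¹-cong : ∀ v w → v ≈ w → inv v ≈ inv w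
      ⁻¹-cong v w p x = begin
        act (inv v) x                       ≡⟨ cong (act (inv v)) (act-invʳ w x) ⟨
        act (inv v) (act w (act (inv w) x)) ≡⟨ cong (act (inv v)) (p _) ⟨
        act (inv v) (act v (act (inv w) x)) ≡⟨ act-invˡ v _ ⟩
        act (inv w) x                       ∎
        where open ≡-Reasoning

  open GGraph group using (_^ℕ_; _^ℤ_; InCoset; Generated; Generates)

  InOrbit : B → E → E → Set
  InOrbit b p q = ∃ λ k → fold q (gen b) k ≡ p

  act-power : ∀ b k x → act ((b ∷ []) ^ℕ k) x ≡ fold x (gen b) k
  act-power b zero    x = refl
  act-power b (suc k) x = cong (gen b) (act-power b k x)

  act-inverse-power : ∀ b k x → act (inv ((b ∷ []) ^ℕ k)) x ≡ fold x (gen b) (k * m)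
  act-inverse-power b zero    x = refl
  act-inverse-power b (suc k) x = begin
    act (inv ((b ∷ []) ^ℕ k) ++ replicate m b) x        ≡⟨ act-++ (inv ((b ∷ []) ^ℕ k)) _ x ⟩
    act (inv ((b ∷ []) ^ℕ k)) (act (replicate m b) x)   ≡⟨ act-inverse-power b k _ ⟩
    fold (act (replicate m b) x) (gen b) (k * m)        ≡⟨ cong (λ y → fold y (gen b) (k * m)) (act-replicate m b x) ⟩
    fold (fold x (gen b) m) (gen b) (k * m)             ≡⟨ fold-+ x (gen b) (k * m) ⟨
    fold x (gen b) (k * m + m)                          ≡⟨ cong (fold x (gen b)) (+-comm (k * m) m) ⟩
    fold x (gen b) (suc k * m)                          ∎
    where open ≡-Reasoning

  power-orbit : ∀ b z x → InOrbit b (act ((b ∷ []) ^ℤ z) x) x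
  power-orbit b (ℤ.+ k)    x = k , sym (act-power b k x)
  power-orbit b ℤ.-[1+ k ] x = suc k * m , sym (act-inverse-power b (suc k) x)

  coset⇒orbit : ∀ b g x p → InCoset g (b ∷ []) x → InOrbit b (act g p) (act x p)
  coset⇒orbit b g x p (i , g≈bⁱx) =
    let (k , bᵏ≡bⁱ) = power-orbit b i (act x p)
    in  k , trans bᵏ≡bⁱ (trans (sym (act-++ ((b ∷ []) ^ℤ i) x p)) (sym (g≈bⁱx p)))

  Commutes : (E → E) → Set
  Commutes h = ∀ b y → gen b (h y) ≡ h (gen b y)

  act-commutes : ∀ {h} → Commutes h → ∀ w y → act w (h y) ≡ h (act w y)
  act-commutes c []      y = refl
  act-commutes c (b ∷ w) y = trans (cong (gen b) (act-commutes c w y)) (c b (act w y))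

  -- If the commutant of the generators is transitive, the action is free:
  -- a word is determined (up to ≈) by the image of a single point e₀.
  module Free (e₀ : E) (homogeneous : ∀ z → ∃ λ h → Commutes h × h e₀ ≡ z) where

    free : ∀ v w → act v e₀ ≡ act w e₀ → v ≈ w
    free v w eq z with homogeneous z
    ... | h , c , refl = begin
      act v (h e₀) ≡⟨ act-commutes c v e₀ ⟩
      h (act v e₀) ≡⟨ cong h eq ⟩
      h (act w e₀) ≡⟨ act-commutes c w e₀ ⟨
      act w (h e₀) ∎
      where open ≡-Reasoning

    orbit⇒coset : ∀ b g x → InOrbit b (act g e₀) (act x e₀) → InCoset g (b ∷ []) x
    orbit⇒coset b g x (k , eq) = ℤ.+ k , free g ((b ∷ []) ^ℕ k ++ x) (begin
      act g e₀                             ≡⟨ eq ⟨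
      fold (act x e₀) (gen b) k            ≡⟨ act-power b k _ ⟨
      act ((b ∷ []) ^ℕ k) (act x e₀)       ≡⟨ act-++ ((b ∷ []) ^ℕ k) x e₀ ⟨
      act ((b ∷ []) ^ℕ k ++ x) e₀          ∎)
      where open ≡-Reasoning

  letters-generate : ∀ {k} (S : Fin k → Word) → (∀ b → ∃ λ i → S i ≡ b ∷ []) → Generates S
  letters-generate S letters []      = Generated.unit
  letters-generate S letters (b ∷ w) =
    let (i , Sᵢ≡b) = letters b
    in  Generated.mul (subst (Generated S) Sᵢ≡b (Generated.gen i)) (letters-generate S letters w)

module BitVector where

  infixl 6 _⊕_
  _⊕_ : ∀ {n} → Vec Bool n → Vec Bool n → Vec Bool n
  _⊕_ = zipWith _xor_

  0s : ∀ {n} → Vec Bool n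
  0s = Vec.replicate _ false

  ⊕-assoc : ∀ {n} (a b c : Vec Bool n) → (a ⊕ b) ⊕ c ≡ a ⊕ (b ⊕ c)
  ⊕-assoc = zipWith-assoc xor-assoc

  ⊕-comm : ∀ {n} (a b : Vec Bool n) → a ⊕ b ≡ b ⊕ a
  ⊕-comm = zipWith-comm xor-comm

  ⊕-identityˡ : ∀ {n} (a : Vec Bool n) → 0s ⊕ a ≡ a
  ⊕-identityˡ = zipWith-identityˡ xor-identityˡ

  ⊕-identityʳ : ∀ {n} (a : Vec Bool n) → a ⊕ 0s ≡ a
  ⊕-identityʳ = zipWith-identityʳ xor-identityʳ

  ⊕-self : ∀ {n} (a : Vec Bool n) → a ⊕ a ≡ 0s
  ⊕-self []      = refl
  ⊕-self (x ∷ a) = cong₂ _∷_ (xor-same x) (⊕-self a)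

  ⊕-cancel : ∀ {n} (a b : Vec Bool n) → (a ⊕ b) ⊕ b ≡ a
  ⊕-cancel a b = begin
    (a ⊕ b) ⊕ b ≡⟨ ⊕-assoc a b b ⟩
    a ⊕ (b ⊕ b) ≡⟨ cong (a ⊕_) (⊕-self b) ⟩
    a ⊕ 0s      ≡⟨ ⊕-identityʳ a ⟩
    a           ∎
    where open ≡-Reasoning

  ⊕-cancelˡ : ∀ {n} (a b c : Vec Bool n) → a ⊕ b ≡ a ⊕ c → b ≡ c
  ⊕-cancelˡ a b c eq = begin
    b           ≡⟨ ⊕-cancel b a ⟨
    (b ⊕ a) ⊕ a ≡⟨ cong (_⊕ a) (⊕-comm b a) ⟩
    (a ⊕ b) ⊕ a ≡⟨ cong (_⊕ a) eq ⟩
    (a ⊕ c) ⊕ a ≡⟨ cong (_⊕ a) (⊕-comm a c) ⟩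
    (c ⊕ a) ⊕ a ≡⟨ ⊕-cancel c a ⟩
    c           ∎
    where open ≡-Reasoning

  ⊕-swap : ∀ {n} (a b c : Vec Bool n) → (a ⊕ b) ⊕ c ≡ (a ⊕ c) ⊕ b
  ⊕-swap a b c = begin
    (a ⊕ b) ⊕ c ≡⟨ ⊕-assoc a b c ⟩
    a ⊕ (b ⊕ c) ≡⟨ cong (a ⊕_) (⊕-comm b c) ⟩
    a ⊕ (c ⊕ b) ≡⟨ ⊕-assoc a c b ⟨
    (a ⊕ c) ⊕ b ∎
    where open ≡-Reasoning

  e : ∀ {n} → Fin n → Vec Bool n
  e zero    = true ∷ 0s
  e (suc c) = false ∷ e c

  e-injective : ∀ {n} (c d : Fin n) → e c ≡ e d → c ≡ d
  e-injective zero    zero    eq = refl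
  e-injective (suc c) (suc d) eq = cong suc (e-injective c d (cong tail eq))

  lookup-e-same : ∀ {n} (c : Fin n) → lookup (e c) c ≡ true
  lookup-e-same zero    = refl
  lookup-e-same (suc c) = lookup-e-same c

  lookup-e-other : ∀ {n} (c j : Fin n) → j ≢ c → lookup (e c) j ≡ false
  lookup-e-other zero    zero    j≢c = ⊥-elim (j≢c refl)
  lookup-e-other zero    (suc j) j≢c = lookup-replicate j false
  lookup-e-other (suc c) zero    j≢c = refl
  lookup-e-other (suc c) (suc j) j≢c = lookup-e-other c j (j≢c ∘′ cong suc)

  parity : ∀ {n} → Vec Bool n → Bool
  parity []      = false
  parity (x ∷ a) = x xor parity a

  parity-⊕ : ∀ {n} (a b : Vec Bool n) → parity (a ⊕ b) ≡ parity a xor parity b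
  parity-⊕ []      []      = refl
  parity-⊕ (x ∷ a) (y ∷ b) = begin
    (x xor y) xor parity (a ⊕ b)        ≡⟨ cong ((x xor y) xor_) (parity-⊕ a b) ⟩
    (x xor y) xor (parity a xor parity b) ≡⟨ xor-interchange x y (parity a) (parity b) ⟩
    (x xor parity a) xor (y xor parity b) ∎
    where open ≡-Reasoning

  parity-0s : ∀ {n} → parity (0s {n}) ≡ false
  parity-0s {zero}  = refl
  parity-0s {suc n} = parity-0s {n}

  parity-e : ∀ {n} (c : Fin n) → parity (e c) ≡ true
  parity-e {suc n} zero = cong (true xor_) (parity-0s {n})
  parity-e (suc c)      = parity-e c

  parity-flip : ∀ {n} (a : Vec Bool n) c → parity (a ⊕ e c) ≡ not (parity a)
  parity-flip a c = begin
    parity (a ⊕ e c)          ≡⟨ parity-⊕ a (e c) ⟩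
    parity a xor parity (e c) ≡⟨ cong (parity a xor_) (parity-e c) ⟩
    parity a xor true         ≡⟨ xor-comm (parity a) true ⟩
    not (parity a)            ∎
    where open ≡-Reasoning

  lookup-flip-same : ∀ {n} (a : Vec Bool n) c → lookup (a ⊕ e c) c ≡ not (lookup a c)
  lookup-flip-same a c = begin
    lookup (a ⊕ e c) c               ≡⟨ lookup-zipWith _xor_ c a (e c) ⟩
    lookup a c xor lookup (e c) c    ≡⟨ cong (lookup a c xor_) (lookup-e-same c) ⟩
    lookup a c xor true              ≡⟨ xor-comm (lookup a c) true ⟩
    not (lookup a c)                 ∎
    where open ≡-Reasoning

  lookup-flip-other : ∀ {n} (a : Vec Bool n) c j → j ≢ c → lookup (a ⊕ e c) j ≡ lookup a j
  lookup-flip-other a c j j≢c = begin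
    lookup (a ⊕ e c) j               ≡⟨ lookup-zipWith _xor_ j a (e c) ⟩
    lookup a j xor lookup (e c) j    ≡⟨ cong (lookup a j xor_) (lookup-e-other c j j≢c) ⟩
    lookup a j xor false             ≡⟨ xor-identityʳ (lookup a j) ⟩
    lookup a j                       ∎
    where open ≡-Reasoning

  lookup-extensionality : ∀ {A : Set} {n} (a b : Vec A n) → (∀ j → lookup a j ≡ lookup b j) → a ≡ b
  lookup-extensionality a b eq = begin
    a                  ≡⟨ tabulate∘lookup a ⟨
    tabulate (lookup a) ≡⟨ tabulate-cong eq ⟩
    tabulate (lookup b) ≡⟨ tabulate∘lookup b ⟩
    b                  ∎
    where open ≡-Reasoning

  QAdj⇒flip : ∀ {n} (u v : Vec Bool n) → QAdj u v → ∃ λ c → v ≡ u ⊕ e c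
  QAdj⇒flip u v (c , differ , agree) = c , lookup-extensionality v (u ⊕ e c) coordinate
    where
      coordinate : ∀ j → lookup v j ≡ lookup (u ⊕ e c) j
      coordinate j with j ≟ c
      ... | yes refl = trans (¬-not (differ ∘′ sym)) (sym (lookup-flip-same u c))
      ... | no  j≢c  = trans (sym (agree j j≢c)) (sym (lookup-flip-other u c j j≢c))

  flip⇒QAdj : ∀ {n} (u : Vec Bool n) c → QAdj u (u ⊕ e c)
  flip⇒QAdj u c = c , (λ eq → not-¬ refl (trans eq (lookup-flip-same u c)))
                    , (λ j j≢c → sym (lookup-flip-other u c j j≢c))

  QAdj-sym : ∀ {n} (u v : Vec Bool n) → QAdj u v → QAdj v u
  QAdj-sym u v (c , differ , agree) = c , differ ∘′ sym , λ j j≢c → sym (agree j j≢c)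

  QAdj-parity : ∀ {n} (u v : Vec Bool n) → QAdj u v → parity v ≡ not (parity u)
  QAdj-parity u v adj with QAdj⇒flip u v adj
  ... | c , refl = parity-flip u c

open BitVector

even-span : ∀ m (Q : Vec Bool (suc m) → Set) → Q 0s → (∀ a b → Q a → Q b → Q (a ⊕ b)) →
            (∀ (i : Fin m) → Q (e (inject₁ i) ⊕ e (suc i))) →
            ∀ a → parity a ≡ false → Q a
even-span zero    Q q0 q⊕ qpair (false ∷ []) even = q0
even-span zero    Q q0 q⊕ qpair (true ∷ [])  ()
even-span (suc m) Q q0 q⊕ qpair a            even = span a even
  where
    span-tail : ∀ b → parity b ≡ false → Q (false ∷ b)
    span-tail = even-span m (λ b → Q (false ∷ b)) q0
                  (λ a b → q⊕ (false ∷ a) (false ∷ b)) (λ i → qpair (suc i))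

    -- a leading true is removed with the first pair e 0 ⊕ e 1
    span : ∀ b → parity b ≡ false → Q b
    span (false ∷ b) even = span-tail b even
    span (true ∷ b)  odd  = subst Q first-pair-removed
      (q⊕ _ _ (span-tail (b ⊕ e zero) (trans (parity-flip b zero) odd)) (qpair zero))
      where
        first-pair-removed : (false ∷ (b ⊕ e zero)) ⊕ (e zero ⊕ e (suc zero)) ≡ true ∷ b
        first-pair-removed = cong (true ∷_)
          (trans (cong ((b ⊕ e zero) ⊕_) (⊕-identityˡ (e zero))) (⊕-cancel b (e zero)))

module Cycle {m : ℕ} where

  private
    n : ℕ
    n = suc m

  next : Fin n → Fin n
  next d = suc (toℕ d) mod n

  suc-%-absorb : ∀ a → suc (a % n) % n ≡ suc a % n
  suc-%-absorb a = begin
    (1 + a % n) % n           ≡⟨ %-distribˡ-+ 1 (a % n) n ⟩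
    (1 % n + a % n % n) % n   ≡⟨ cong (λ t → (1 % n + t) % n) (m%n%n≡m%n a n) ⟩
    (1 % n + a % n) % n       ≡⟨ %-distribˡ-+ 1 a n ⟨
    (1 + a) % n               ∎
    where open ≡-Reasoning

  toℕ-next-iterate : ∀ d k → toℕ (fold d next k) ≡ (toℕ d + k) % n
  toℕ-next-iterate d zero = begin
    toℕ d             ≡⟨ m<n⇒m%n≡m (toℕ<n d) ⟨
    toℕ d % n         ≡⟨ cong (_% n) (+-identityʳ (toℕ d)) ⟨
    (toℕ d + 0) % n   ∎
    where open ≡-Reasoning
  toℕ-next-iterate d (suc k) = begin
    toℕ (next (fold d next k))        ≡⟨ toℕ-fromℕ< (m%n<n (suc (toℕ (fold d next k))) n) ⟩
    suc (toℕ (fold d next k)) % n     ≡⟨ cong (λ t → suc t % n) (toℕ-next-iterate d k) ⟩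
    suc ((toℕ d + k) % n) % n         ≡⟨ suc-%-absorb (toℕ d + k) ⟩
    suc (toℕ d + k) % n               ≡⟨ cong (_% n) (+-suc (toℕ d) k) ⟨
    (toℕ d + suc k) % n               ∎
    where open ≡-Reasoning

  next-order : ∀ d → fold d next n ≡ d
  next-order d = toℕ-injective (begin
    toℕ (fold d next n) ≡⟨ toℕ-next-iterate d n ⟩
    (toℕ d + n) % n     ≡⟨ [m+n]%n≡m%n (toℕ d) n ⟩
    toℕ d % n           ≡⟨ m<n⇒m%n≡m (toℕ<n d) ⟩
    toℕ d               ∎)
    where open ≡-Reasoning

  next-transitive : ∀ d d′ → ∃ λ k → fold d next k ≡ d′
  next-transitive d d′ = toℕ d′ + (n ∸ toℕ d) , toℕ-injective (begin
    toℕ (fold d next (toℕ d′ + (n ∸ toℕ d)))  ≡⟨ toℕ-next-iterate d _ ⟩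
    (toℕ d + (toℕ d′ + (n ∸ toℕ d))) % n      ≡⟨ cong (_% n) (full-turn (toℕ d) (toℕ d′) (<⇒≤ (toℕ<n d))) ⟩
    (toℕ d′ + n) % n                         ≡⟨ [m+n]%n≡m%n (toℕ d′) n ⟩
    toℕ d′ % n                               ≡⟨ m<n⇒m%n≡m (toℕ<n d′) ⟩
    toℕ d′                                   ∎)
    where
      open ≡-Reasoning
      full-turn : ∀ a b → a ≤ n → a + (b + (n ∸ a)) ≡ b + n
      full-turn a b a≤n = begin
        a + (b + (n ∸ a)) ≡⟨ +-assoc a b (n ∸ a) ⟨
        a + b + (n ∸ a)   ≡⟨ cong (_+ (n ∸ a)) (+-comm a b) ⟩
        b + a + (n ∸ a)   ≡⟨ +-assoc b a (n ∸ a) ⟩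
        b + (a + (n ∸ a)) ≡⟨ cong (b +_) (m+[n∸m]≡n a≤n) ⟩
        b + n             ∎

  previous : Fin n → Fin n
  previous d = fold d next m

  next-previous : ∀ d → next (previous d) ≡ d
  next-previous = next-order

  previous-next : ∀ d → previous (next d) ≡ d
  previous-next d = begin
    fold (next d) next m ≡⟨ fold-+ d next m ⟨
    fold d next (m + 1)  ≡⟨ cong (fold d next) (+-comm m 1) ⟩
    fold d next n        ≡⟨ next-order d ⟩
    d                    ∎
    where open ≡-Reasoning

  next-inject₁ : ∀ (i : Fin m) → next (inject₁ i) ≡ suc i
  next-inject₁ i = toℕ-injective (begin
    toℕ (next (inject₁ i))      ≡⟨ toℕ-fromℕ< (m%n<n (suc (toℕ (inject₁ i))) n) ⟩
    suc (toℕ (inject₁ i)) % n   ≡⟨ cong (λ t → suc t % n) (toℕ-inject₁ i) ⟩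
    suc (toℕ i) % n             ≡⟨ m<n⇒m%n≡m (s≤s (toℕ<n i)) ⟩
    suc (toℕ i)                 ∎)
    where open ≡-Reasoning

module Rotation {m : ℕ} where
  open Cycle {m}

  rotate : Vec Bool (suc m) → Vec Bool (suc m)
  rotate a = tabulate (λ j → lookup a (previous j))

  lookup-rotate : ∀ a j → lookup (rotate a) j ≡ lookup a (previous j)
  lookup-rotate a j = lookup∘tabulate (λ j → lookup a (previous j)) j

  rotate-⊕ : ∀ a b → rotate (a ⊕ b) ≡ rotate a ⊕ rotate b
  rotate-⊕ a b = lookup-extensionality _ _ λ j → begin
    lookup (rotate (a ⊕ b)) j                        ≡⟨ lookup-rotate (a ⊕ b) j ⟩
    lookup (a ⊕ b) (previous j)                      ≡⟨ lookup-zipWith _xor_ (previous j) a b ⟩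
    lookup a (previous j) xor lookup b (previous j)  ≡⟨ cong₂ _xor_ (lookup-rotate a j) (lookup-rotate b j) ⟨
    lookup (rotate a) j xor lookup (rotate b) j      ≡⟨ lookup-zipWith _xor_ j (rotate a) (rotate b) ⟨
    lookup (rotate a ⊕ rotate b) j                   ∎
    where open ≡-Reasoning

  rotate-0s : rotate 0s ≡ 0s
  rotate-0s = lookup-extensionality _ _ λ j →
    trans (lookup-rotate 0s j) (trans (lookup-replicate (previous j) false) (sym (lookup-replicate j false)))

  rotate-e : ∀ d → rotate (e d) ≡ e (next d)
  rotate-e d = lookup-extensionality _ _ λ j → trans (lookup-rotate (e d) j) (coordinate j)
    where
      coordinate : ∀ j → lookup (e d) (previous j) ≡ lookup (e (next d)) j
      coordinate j with j ≟ next d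
      ... | yes refl = trans (cong (lookup (e d)) (previous-next d)) (trans (lookup-e-same d) (sym (lookup-e-same (next d))))
      ... | no  j≢nd = trans (lookup-e-other d (previous j) λ pj≡d → j≢nd (trans (sym (next-previous j)) (cong next pj≡d)))
                             (sym (lookup-e-other (next d) j j≢nd))

module HypercubeAction (m : ℕ) where
  open Cycle {m}
  open Rotation {m}

  State : Set
  State = Vec Bool (suc m) × Fin (suc m)

  -- both letters turn to the next direction; letter false pivots the edge
  -- {u , u ⊕ e d} about u, letter true pivots it about u ⊕ e d
  move : Bool → State → State
  move false (u , d) = u , next d
  move true  (u , d) = u ⊕ (e d ⊕ e (next d)) , next d

  move-false-iterate : ∀ u d k → fold (u , d) (move false) k ≡ (u , fold d next k)
  move-false-iterate u d zero    = refl
  move-false-iterate u d (suc k) = cong (move false) (move-false-iterate u d k)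

  move-true-iterate : ∀ u d k →
    fold (u , d) (move true) k ≡ (u ⊕ (e d ⊕ e (fold d next k)) , fold d next k)
  move-true-iterate u d zero = cong (_, d) (sym (trans (cong (u ⊕_) (⊕-self (e d))) (⊕-identityʳ u)))
  move-true-iterate u d (suc k) rewrite move-true-iterate u d k =
    cong (_, next d′) (begin
      (u ⊕ (e d ⊕ e d′)) ⊕ (e d′ ⊕ e (next d′)) ≡⟨ ⊕-assoc u _ _ ⟩
      u ⊕ ((e d ⊕ e d′) ⊕ (e d′ ⊕ e (next d′))) ≡⟨ cong (u ⊕_) (⊕-assoc (e d ⊕ e d′) (e d′) _) ⟨
      u ⊕ (((e d ⊕ e d′) ⊕ e d′) ⊕ e (next d′)) ≡⟨ cong (λ t → u ⊕ (t ⊕ e (next d′))) (⊕-cancel (e d) (e d′)) ⟩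
      u ⊕ (e d ⊕ e (next d′))                   ∎)
    where
      open ≡-Reasoning
      d′ = fold d next k

  move-order : ∀ b p → fold p (move b) (suc m) ≡ p
  move-order false (u , d) = trans (move-false-iterate u d (suc m)) (cong (u ,_) (next-order d))
  move-order true  (u , d) rewrite move-true-iterate u d (suc m) | next-order d
    = cong (_, d) (trans (cong (u ⊕_) (⊕-self (e d))) (⊕-identityʳ u))

  open WordGroup move m move-order public

  -- the two endpoints of the edge encoded by a state; vertex b is constant
  -- exactly along the orbits of move b
  vertex : Bool → State → Vec Bool (suc m)
  vertex false (u , d) = u
  vertex true  (u , d) = u ⊕ e d

  vertex-move : ∀ b p → vertex b (move b p) ≡ vertex b p
  vertex-move false (u , d) = refl
  vertex-move true  (u , d) = begin
    (u ⊕ (e d ⊕ e (next d))) ⊕ e (next d) ≡⟨ ⊕-assoc u _ _ ⟩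
    u ⊕ ((e d ⊕ e (next d)) ⊕ e (next d)) ≡⟨ cong (u ⊕_) (⊕-cancel (e d) (e (next d))) ⟩
    u ⊕ e d                               ∎
    where open ≡-Reasoning

  vertex-move-iterate : ∀ b p k → vertex b (fold p (move b) k) ≡ vertex b p
  vertex-move-iterate b p zero    = refl
  vertex-move-iterate b p (suc k) = trans (vertex-move b _) (vertex-move-iterate b p k)

  vertex-complete : ∀ b p q → vertex b p ≡ vertex b q → InOrbit b p q
  vertex-complete false (u , d) (u′ , d′) u≡u′ with next-transitive d′ d
  ... | k , reach = k , trans (move-false-iterate u′ d′ k) (cong₂ _,_ (sym u≡u′) reach)
  vertex-complete true  (u , d) (u′ , d′) same with next-transitive d′ d
  ... | k , refl = k , trans (move-true-iterate u′ d′ k) (cong (_, fold d′ next k) (begin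
    u′ ⊕ (e d′ ⊕ e d) ≡⟨ ⊕-assoc u′ (e d′) (e d) ⟨
    (u′ ⊕ e d′) ⊕ e d ≡⟨ cong (_⊕ e d) same ⟨
    (u ⊕ e d) ⊕ e d   ≡⟨ ⊕-cancel u (e d) ⟩
    u                 ∎))
    where open ≡-Reasoning

  vertices-injective : ∀ p q → vertex false p ≡ vertex false q → vertex true p ≡ vertex true q → p ≡ q
  vertices-injective (u , d) (.u , d′) refl same = cong (u ,_) (e-injective d d′ (⊕-cancelˡ u (e d) (e d′) same))

  vertices-adjacent : ∀ p → QAdj (vertex false p) (vertex true p)
  vertices-adjacent (u , d) = flip⇒QAdj u d

  translate : Vec Bool (suc m) → State → State
  translate a (u , d) = u ⊕ a , d

  translate-commutes : ∀ a → Commutes (translate a)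
  translate-commutes a false (u , d) = refl
  translate-commutes a true  (u , d) = cong (_, next d) (⊕-swap u a (e d ⊕ e (next d)))

  turn : State → State
  turn (u , d) = rotate u , next d

  turn-commutes : Commutes turn
  turn-commutes false (u , d) = refl
  turn-commutes true  (u , d) = cong (_, next (next d)) (sym (begin
    rotate (u ⊕ (e d ⊕ e (next d)))           ≡⟨ rotate-⊕ u _ ⟩
    rotate u ⊕ rotate (e d ⊕ e (next d))      ≡⟨ cong (rotate u ⊕_) (rotate-⊕ (e d) (e (next d))) ⟩
    rotate u ⊕ (rotate (e d) ⊕ rotate (e (next d)))
      ≡⟨ cong (rotate u ⊕_) (cong₂ _⊕_ (rotate-e d) (rotate-e (next d))) ⟩
    rotate u ⊕ (e (next d) ⊕ e (next (next d))) ∎))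
    where open ≡-Reasoning

  iterate-commutes : ∀ {h} → Commutes h → ∀ k → Commutes (λ p → fold p h k)
  iterate-commutes     c zero    b p = refl
  iterate-commutes {h} c (suc k) b p = trans (c b _) (cong h (iterate-commutes c k b p))

  origin : State
  origin = 0s , zero

  turn-iterate-origin : ∀ k → fold origin turn k ≡ (0s , fold zero next k)
  turn-iterate-origin zero    = refl
  turn-iterate-origin (suc k) rewrite turn-iterate-origin k = cong (_, next (fold zero next k)) rotate-0s

  homogeneous : ∀ p → ∃ λ h → Commutes h × h origin ≡ p
  homogeneous (u , d) with next-transitive zero d
  ... | k , reach = (λ p → translate u (fold p turn k))
                  , (λ b p → trans (translate-commutes u b _) (cong (translate u) (iterate-commutes turn-commutes k b p)))
                  , trans (cong (translate u) (turn-iterate-origin k)) (cong₂ _,_ (⊕-identityˡ u) reach)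

  open Free origin homogeneous public

  parity-move : ∀ b p → parity (proj₁ (move b p)) ≡ parity (proj₁ p)
  parity-move false (u , d) = refl
  parity-move true  (u , d) = begin
    parity (u ⊕ (e d ⊕ e (next d)))              ≡⟨ parity-⊕ u _ ⟩
    parity u xor parity (e d ⊕ e (next d))       ≡⟨ cong (parity u xor_) (parity-⊕ (e d) (e (next d))) ⟩
    parity u xor (parity (e d) xor parity (e (next d)))
      ≡⟨ cong (parity u xor_) (cong₂ _xor_ (parity-e d) (parity-e (next d))) ⟩
    parity u xor false                           ≡⟨ xor-identityʳ (parity u) ⟩
    parity u                                     ∎
    where open ≡-Reasoning

  parity-act : ∀ w → parity (proj₁ (act w origin)) ≡ false
  parity-act []      = parity-0s {suc m}
  parity-act (b ∷ w) = trans (parity-move b (act w origin)) (parity-act w)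

  Reachable : State → Set
  Reachable p = ∃ λ w → act w origin ≡ p

  reachable-move : ∀ b {p} → Reachable p → Reachable (move b p)
  reachable-move b (w , reach) = b ∷ w , cong (move b) reach

  reachable-turn : ∀ {a d} d′ → Reachable (a , d) → Reachable (a , d′)
  reachable-turn {a} {d} d′ (w , reach) with next-transitive d d′
  ... | k , d→d′ = replicate k false ++ w , (begin
    act (replicate k false ++ w) origin          ≡⟨ act-++ (replicate k false) w origin ⟩
    act (replicate k false) (act w origin)       ≡⟨ cong (act (replicate k false)) reach ⟩
    act (replicate k false) (a , d)              ≡⟨ act-replicate k false (a , d) ⟩
    fold (a , d) (move false) k                  ≡⟨ move-false-iterate a d k ⟩
    (a , fold d next k)                          ≡⟨ cong (a ,_) d→d′ ⟩
    (a , d′)                                     ∎)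
    where open ≡-Reasoning

  -- reachable vertex components (at direction zero) are closed under ⊕,
  -- because translations commute with the action
  reachable-⊕ : ∀ a b → Reachable (a , zero) → Reachable (b , zero) → Reachable (a ⊕ b , zero)
  reachable-⊕ a b (wa , reach-a) (wb , reach-b) = wb ++ wa , (begin
    act (wb ++ wa) origin          ≡⟨ act-++ wb wa origin ⟩
    act wb (act wa origin)         ≡⟨ cong (act wb) (trans reach-a (cong (_, zero) (sym (⊕-identityˡ a)))) ⟩
    act wb (translate a origin)    ≡⟨ act-commutes (translate-commutes a) wb origin ⟩
    translate a (act wb origin)    ≡⟨ cong (translate a) reach-b ⟩
    (b ⊕ a , zero)                 ≡⟨ cong (_, zero) (⊕-comm b a) ⟩
    (a ⊕ b , zero)                 ∎)
    where open ≡-Reasoning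

  -- a move true from direction i flips the adjacent pair e i ⊕ e (i + 1)
  reachable-pair : ∀ (i : Fin m) → Reachable (e (inject₁ i) ⊕ e (suc i) , zero)
  reachable-pair i = reachable-turn zero (subst Reachable flipped
                       (reachable-move true (reachable-turn (inject₁ i) ([] , refl))))
    where
      flipped : move true (0s , inject₁ i) ≡ (e (inject₁ i) ⊕ e (suc i) , suc i)
      flipped rewrite next-inject₁ i = cong (_, suc i) (⊕-identityˡ _)

  even-reachable : ∀ a → parity a ≡ false → ∀ d → Reachable (a , d)
  even-reachable a even d = reachable-turn d
    (even-span m (λ a → Reachable (a , zero)) ([] , refl) reachable-⊕ reachable-pair a even)

-- The G-graph Γ(G , {s₀ , s₁}) of the word group of HypercubeAction m and its
-- identification with Q_{suc m}: the coset ⟨s_b⟩x is labelled by the vertex b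
-- of the state reached from the origin by x.
module HypercubeGGraph (m : ℕ) where
  open HypercubeAction m
  open GGraph group using (Vertex; InCoset; SameVertex; HasExactly; EdgeMult; Generates; IsoToHypercube)

  part : Fin 2 → Bool
  part zero       = false
  part (suc zero) = true

  S : Fin 2 → Word
  S i = part i ∷ []

  S-generates : Generates S
  S-generates = letters-generate S λ { false → zero , refl ; true → suc zero , refl }

  coset⇒same-vertex : ∀ b g x → InCoset g (b ∷ []) x → vertex b (act g origin) ≡ vertex b (act x origin)
  coset⇒same-vertex b g x coset =
    let (k , orbit) = coset⇒orbit b g x origin coset
    in  trans (cong (vertex b) (sym orbit)) (vertex-move-iterate b (act x origin) k)

  same-vertex⇒coset : ∀ b g x → vertex b (act g origin) ≡ vertex b (act x origin) → InCoset g (b ∷ []) x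
  same-vertex⇒coset b g x same = orbit⇒coset b g x (vertex-complete b _ _ same)

  label : Vertex 2 → Vec Bool (suc m)
  label (i , x) = vertex (part i) (act x origin)

  parity-label : ∀ i x → parity (label (i , x)) ≡ part i
  parity-label i x = parity-vertex (part i) (act x origin) (parity-act x)
    where
      parity-vertex : ∀ b p → parity (proj₁ p) ≡ false → parity (vertex b p) ≡ b
      parity-vertex false (u , d) even = even
      parity-vertex true  (u , d) even = trans (parity-flip u d) (cong not even)

  parts-disjoint : ∀ x y → label (zero , x) ≢ label (suc zero , y)
  parts-disjoint x y same with trans (sym (parity-label zero x)) (trans (cong parity same) (parity-label (suc zero) y))
  ... | ()

  label-respects : ∀ u v → SameVertex S u v → label u ≡ label v
  label-respects (i , x) (.i , y) (refl , coset) = coset⇒same-vertex (part i) x y coset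

  label-reflects : ∀ u v → label u ≡ label v → SameVertex S u v
  label-reflects (zero , x)     (zero , y)     same = refl , same-vertex⇒coset false x y same
  label-reflects (suc zero , x) (suc zero , y) same = refl , same-vertex⇒coset true x y same
  label-reflects (zero , x)     (suc zero , y) same = ⊥-elim (parts-disjoint x y same)
  label-reflects (suc zero , x) (zero , y)     same = ⊥-elim (parts-disjoint y x (sym same))

  label-surjective : ∀ w → ∃ λ u → label u ≡ w
  label-surjective w = by-parity (parity w) refl
    where
      by-parity : ∀ b → parity w ≡ b → ∃ λ u → label u ≡ w
      by-parity false even =
        let (x , reach) = even-reachable w even zero
        in  (zero , x) , cong (vertex false) reach
      by-parity true  odd  =
        let (x , reach) = even-reachable (w ⊕ e zero) (trans (parity-flip w zero) (cong not odd)) zero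
        in  (suc zero , x) , trans (cong (vertex true) reach) (⊕-cancel w (e zero))

  exactly-none : ∀ {P : Word → Set} → (∀ g → ¬ P g) → HasExactly P 0
  exactly-none none = (λ ()) , (λ ()) , (λ ()) , λ g p → ⊥-elim (none g p)

  exactly-one : ∀ {P : Word → Set} g → P g → (∀ g′ → P g′ → g′ ≈ g) → HasExactly P 1
  exactly-one g p unique = (λ _ → g) , (λ _ → p) , (λ { zero zero _ → refl }) , λ g′ p′ → zero , unique g′ p′

  exactly-swap : ∀ {P Q : Word → Set} k → HasExactly (λ g → P g × Q g) k → HasExactly (λ g → Q g × P g) k
  exactly-swap k (enum , members , injective , complete) =
    enum , (λ a → proj₂ (members a) , proj₁ (members a)) , injective , λ g (q , p) → complete g (p , q)

  -- words in both ⟨S 0⟩x and ⟨S 1⟩y: they correspond to the hypercube edges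
  -- between the labels of the two cosets
  Common : Word → Word → Word → Set
  Common x y g = InCoset g (false ∷ []) x × InCoset g (true ∷ []) y

  -- two cosets ⟨s₀⟩x and ⟨s₁⟩y meet in at most one element: a state is
  -- determined by its two vertices and the action is free
  common-unique : ∀ x y g g′ → Common x y g → Common x y g′ → g ≈ g′
  common-unique x y g g′ (gx , gy) (g′x , g′y) = free g g′ (vertices-injective _ _
    (trans (coset⇒same-vertex false g x gx) (sym (coset⇒same-vertex false g′ x g′x)))
    (trans (coset⇒same-vertex true g y gy) (sym (coset⇒same-vertex true g′ y g′y))))

  common⇒adjacent : ∀ x y g → Common x y g → QAdj (label (zero , x)) (label (suc zero , y))
  common⇒adjacent x y g (gx , gy) =
    subst₂ QAdj (coset⇒same-vertex false g x gx) (coset⇒same-vertex true g y gy) (vertices-adjacent (act g origin))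

  -- if their labels are adjacent, the edge between them is a reachable state
  adjacent⇒common : ∀ x y → QAdj (label (zero , x)) (label (suc zero , y)) → ∃ (Common x y)
  adjacent⇒common x y adj =
    let (c , flip)  = QAdj⇒flip _ _ adj
        (g , reach) = even-reachable (label (zero , x)) (parity-label zero x) c
    in  g , same-vertex⇒coset false g x (cong (vertex false) reach)
          , same-vertex⇒coset true g y (trans (cong (vertex true) reach) (sym flip))

  crossing : ∀ x y → (QAdj (label (zero , x)) (label (suc zero , y)) → HasExactly (Common x y) 1)
                   × (¬ QAdj (label (zero , x)) (label (suc zero , y)) → HasExactly (Common x y) 0)
  crossing x y = (λ adj → exists (adjacent⇒common x y adj))
               , λ ¬adj → exactly-none {Common x y} λ g common → ¬adj (common⇒adjacent x y g common)
    where
      exists : ∃ (Common x y) → HasExactly (Common x y) 1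
      exists (g , common) = exactly-one {Common x y} g common λ g′ common′ → common-unique x y g′ g common′ common

  adjacent⇒different-parts : ∀ i j x y → QAdj (label (i , x)) (label (j , y)) → i ≢ j
  adjacent⇒different-parts i .i x y adj refl = not-¬ refl (begin
    part i                      ≡⟨ parity-label i y ⟨
    parity (label (i , y))      ≡⟨ QAdj-parity (label (i , x)) (label (i , y)) adj ⟩
    not (parity (label (i , x))) ≡⟨ cong not (parity-label i x) ⟩
    not (part i)                ∎)
    where open ≡-Reasoning

  edge-multiplicity : ∀ u v → (QAdj (label u) (label v) → EdgeMult S u v 1)
                            × (¬ QAdj (label u) (label v) → EdgeMult S u v 0)
  edge-multiplicity (i , x) (j , y) =
    (λ adj → (λ i≡j → ⊥-elim (adjacent⇒different-parts i j x y adj i≡j)) , one i j adj)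
    , λ ¬adj → (λ _ → refl) , none i j ¬adj
    where
      one : ∀ i j → QAdj (label (i , x)) (label (j , y)) → i ≢ j →
            HasExactly (λ g → InCoset g (S i) x × InCoset g (S j) y) 1
      one zero       zero       adj i≢j = ⊥-elim (i≢j refl)
      one zero       (suc zero) adj i≢j = proj₁ (crossing x y) adj
      one (suc zero) zero       adj i≢j = exactly-swap 1 (proj₁ (crossing y x) (QAdj-sym (label (suc zero , x)) (label (zero , y)) adj))
      one (suc zero) (suc zero) adj i≢j = ⊥-elim (i≢j refl)
      none : ∀ i j → ¬ QAdj (label (i , x)) (label (j , y)) → i ≢ j →
             HasExactly (λ g → InCoset g (S i) x × InCoset g (S j) y) 0
      none zero       zero       ¬adj i≢j = ⊥-elim (i≢j refl)
      none zero       (suc zero) ¬adj i≢j = proj₂ (crossing x y) ¬adj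
      none (suc zero) zero       ¬adj i≢j = exactly-swap 0 (proj₂ (crossing y x) (¬adj ∘′ QAdj-sym (label (zero , y)) (label (suc zero , x))))
      none (suc zero) (suc zero) ¬adj i≢j = ⊥-elim (i≢j refl)

  isomorphism : IsoToHypercube S (suc m)
  isomorphism = label , label-respects , label-reflects , label-surjective , edge-multiplicity

proposition6p7p1 : (n : ℕ) → 1 ≤ n → HypercubeIsGGraph n
proposition6p7p1 (suc m) (s≤s z≤n) = HypercubeAction.group m , 2 , S , S-generates , isomorphism
  where open HypercubeGGraph m
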